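{- Let $C$ be a reaction cycle $y_1\to y_2\to\cdots\to y_\ell\to y_1$ of length $\ell\ge2$ in a chemical reaction network $N$. Then no vertex of $\mathcal H_N$ corresponding to a complex (reactant or product) of one of the reactions on $C$ is almost balanced.
   Context: A chemical reaction network $N=(\mathscr S,\mathscr C,\mathscr R)$ consists of a finite set of species $\mathscr S$, complexes $\mathscr C\subseteq\mathbb Z_{\ge0}^{\mathscr S}$, and reactions $y\to y'$ with $y\ne y'$; every complex occurs in some reaction, every species lies in some complex's support, and there are no reactions $\varnothing\to y$. A reaction cycle of length $\ell\ge2$ is a sequence of reactions $y_1\to\cdots\to y_\ell\to y_1$ of $N$ with $y_1,\dots,y_\ell$ distinct complexes. Reactions of $N$ are indexed $1,\dots,m$, the $i$-th written $z_i\to z_i'$. The network hypergraph $\mathcal H_N$ has $2m$ vertices $u_1,v_1,\dots,u_m,v_m$ ($u_i$ corresponds to the reactant $z_i$ of reaction $i$, $v_i$ to its product $z_i'$). Hyperedges: for each species $s$, $E_s=\{u_i: s\in\mathrm{supp}(z_i)\}\cup\{v_i: s\in\mathrm{supp}(z_i')\}$; for each reaction $i$, $E_i=\{u_i,v_i\}$ if $z_i'\ne\varnothing$ and $E_i=\varnothing$ otherwise. A vertex $w$ is almost balanced if there is a multiset $\mathscr E$ of edges (nonnegative multiplicities) and a splitting $\mathscr E=\mathscr E_r\sqcup\mathscr E_b$ into two submultisets whose multiplicities add up, such that, writing $\deg_{\mathscr E_c}(z)$ for the number of edges of $\mathscr E_c$ (with multiplicity) containing $z$, $\deg_{\mathscr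 E_r}(w)=\deg_{\mathscr E_b}(w)+k$ for some positive integer $k$ and $\deg_{\mathscr E_r}(z)=\deg_{\mathscr E_b}(z)$ for every other vertex $z$. -}

module Defs where

open import Data.Nat using (ℕ; zero; suc; _+_; _*_; _≤_; _<_; _≡ᵇ_)
open import Data.Nat.DivMod using (_%_; m%n<n)
open import Data.Fin using (Fin; toℕ; fromℕ<; _≟_)
open import Data.Vec using (Vec; lookup; replicate)
open import Data.Bool using (Bool; true; false; _∧_; not; if_then_else_)
open import Data.Sum using (_⊎_; inj₁; inj₂)
open import Data.Product using (Σ; ∃; ∃-syntax; _×_; _,_)
open import Relation.Nullary using (¬_; does)
open import Relation.Binary.PropositionalEquality using (_≡_; _≢_)
open import Data.Vec.Properties using (≡-dec)
import Data.Nat.Properties as ℕP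

Complex : ℕ → Set
Complex n = Vec ℕ n

-- The set of complexes is the set of
-- complexes occurring in some reaction (so every complex occurs in a reaction).
record CRN (n m : ℕ) : Set where
  field
    reactant    : Fin m → Complex n
    product     : Fin m → Complex n
    nontrivial  : ∀ i → reactant i ≢ product i
    -- the reactions form a set: the indexing is injective
    distinct    : ∀ i j → reactant i ≡ reactant j → product i ≡ product j → i ≡ j
    speciesUsed : ∀ s → ∃[ i ] (lookup (reactant i) s ≢ 0 ⊎ lookup (product i) s ≢ 0)
    noInflow    : ∀ i → reactant i ≢ replicate n 0
open CRN public

next : ∀ {k} → Fin (suc k) → Fin (suc k)
next {k} j = fromℕ< (m%n<n (suc (toℕ j)) (suc k))

-- A reaction cycle of length ℓ = suc k ≥ 2: distinct complexes y_0 … y_k and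
-- reactions rxn j of N with rxn j = (y j → y (j+1 mod ℓ)).
record Cycle {n m : ℕ} (N : CRN n m) (k : ℕ) : Set where
  field
    length≥2  : 2 ≤ suc k
    y         : Fin (suc k) → Complex n
    y-inj     : ∀ i j → y i ≡ y j → i ≡ j
    rxn       : Fin (suc k) → Fin m
    rxn-src   : ∀ j → reactant N (rxn j) ≡ y j
    rxn-tgt   : ∀ j → product N (rxn j) ≡ y (next j)
open Cycle public

-- Vertices of the network hypergraph H_N: u i (reactant of reaction i), v i (product).
data Vertex (m : ℕ) : Set where
  u : Fin m → Vertex m
  v : Fin m → Vertex m

-- Edge labels: species edges E_s (inj₁ s) and reaction edges E_i (inj₂ i).
Edge : ℕ → ℕ → Set
Edge n m = Fin n ⊎ Fin m

inSupp : ∀ {n} → Complex n → Fin n → Bool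
inSupp z s = not (lookup z s ≡ᵇ 0)

isZero : ∀ {n} → Complex n → Bool
isZero {n} z = does (≡-dec ℕP._≟_ z (replicate n 0))

mem : ∀ {n m} → CRN n m → Edge n m → Vertex m → Bool
mem N (inj₁ s) (u i) = inSupp (reactant N i) s
mem N (inj₁ s) (v i) = inSupp (product N i) s
mem N (inj₂ j) (u i) = does (j ≟ i) ∧ not (isZero (product N j))
mem N (inj₂ j) (v i) = does (j ≟ i) ∧ not (isZero (product N j))

ind : Bool → ℕ
ind b = if b then 1 else 0

sumFin : ∀ {k} → (Fin k → ℕ) → ℕ
sumFin {zero}  f = 0
sumFin {suc k} f = f Fin.zero + sumFin (λ i → f (Fin.suc i))

sumEdge : ∀ {n m} → (Edge n m → ℕ) → ℕ
sumEdge f = sumFin (λ s → f (inj₁ s)) + sumFin (λ i → f (inj₂ i))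

deg : ∀ {n m} → CRN n m → (Edge n m → ℕ) → Vertex m → ℕ
deg N μ z = sumEdge (λ e → μ e * ind (mem N e z))

-- w is almost balanced: a multiset of edges split into E_r (multiplicities r)
-- and E_b (multiplicities b) with deg_r w = deg_b w + k, k > 0, and
-- deg_r z = deg_b z for every other vertex z.
AlmostBalanced : ∀ {n m} → CRN n m → Vertex m → Set
AlmostBalanced {n} {m} N w =
  Σ (Edge n m → ℕ) λ r → Σ (Edge n m → ℕ) λ b → Σ ℕ λ k →
    (0 < k) × (deg N r w ≡ deg N b w + k) × (∀ z → z ≢ w → deg N r z ≡ deg N b z)

-- For any multiset of edges μ, the degrees of the reactant vertices of the reactions on the
-- cycle and those of their product vertices have the same total: a reaction edge contains
-- both vertices of its reaction, and the species edges see the complexes y₁ … y_ℓ once on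
-- each side, only rotated by one step. An almost balanced vertex on the cycle would make the
-- red and blue totals on its side differ by k > 0, while they agree on the other side.
module Submission where

open import Defs
open import Data.Nat using (ℕ; zero; suc; _+_; _*_; _<_; s≤s)
open import Data.Nat.Properties
  using (+-comm; +-assoc; +-identityʳ; +-cancelˡ-≡; <⇒≢; +-commutativeSemigroup)
open import Data.Nat.DivMod using (_%_; m<n⇒m%n≡m; n%n≡0)
open import Data.Fin using (Fin; toℕ; inject₁; fromℕ)
open import Data.Fin.Properties using (toℕ-injective; toℕ-fromℕ<; toℕ-inject₁; toℕ-fromℕ; toℕ<n; suc-injective)
open import Data.Sum using (inj₁; inj₂)
open import Data.Product using (_×_; _,_)
open import Function using (_∘_)
open import Relation.Nullary using (¬_)
open import Relation.Binary.PropositionalEquality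
  using (_≡_; _≢_; refl; sym; trans; cong; cong₂; module ≡-Reasoning)
open import Algebra.Properties.CommutativeSemigroup +-commutativeSemigroup using (interchange)
open ≡-Reasoning

next-inject₁ : ∀ {k} (i : Fin k) → next (inject₁ i) ≡ Fin.suc i
next-inject₁ {k} i = toℕ-injective (begin
  toℕ (next (inject₁ i))        ≡⟨ toℕ-fromℕ< _ ⟩
  suc (toℕ (inject₁ i)) % suc k ≡⟨ cong (λ t → suc t % suc k) (toℕ-inject₁ i) ⟩
  suc (toℕ i) % suc k           ≡⟨ m<n⇒m%n≡m (s≤s (toℕ<n i)) ⟩
  suc (toℕ i)                   ∎)

next-fromℕ : ∀ k → next (fromℕ k) ≡ Fin.zero
next-fromℕ k = toℕ-injective (trans (toℕ-fromℕ< _)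
  (trans (cong (λ t → suc t % suc k) (toℕ-fromℕ k)) (n%n≡0 (suc k))))

sumFin-cong : ∀ {k} {f g : Fin k → ℕ} → (∀ j → f j ≡ g j) → sumFin f ≡ sumFin g
sumFin-cong {zero}  f≡g = refl
sumFin-cong {suc k} f≡g = cong₂ _+_ (f≡g Fin.zero) (sumFin-cong (f≡g ∘ Fin.suc))

sumFin-+ : ∀ {k} (f g : Fin k → ℕ) → sumFin (λ j → f j + g j) ≡ sumFin f + sumFin g
sumFin-+ {zero}  f g = refl
sumFin-+ {suc k} f g = begin
  (f Fin.zero + g Fin.zero) + sumFin (λ j → f (Fin.suc j) + g (Fin.suc j))
    ≡⟨ cong ((f Fin.zero + g Fin.zero) +_) (sumFin-+ (f ∘ Fin.suc) (g ∘ Fin.suc)) ⟩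
  (f Fin.zero + g Fin.zero) + (sumFin (f ∘ Fin.suc) + sumFin (g ∘ Fin.suc))
    ≡⟨ interchange (f Fin.zero) (g Fin.zero) _ _ ⟩
  sumFin f + sumFin g ∎

sumFin-last : ∀ {k} (f : Fin (suc k) → ℕ) → sumFin f ≡ sumFin (f ∘ inject₁) + f (fromℕ k)
sumFin-last {zero}  f = +-comm (f Fin.zero) 0
sumFin-last {suc k} f = trans (cong (f Fin.zero +_) (sumFin-last (f ∘ Fin.suc)))
                              (sym (+-assoc (f Fin.zero) _ _))

sumFin-next : ∀ {k} (f : Fin (suc k) → ℕ) → sumFin (f ∘ next) ≡ sumFin f
sumFin-next {k} f = begin
  sumFin (f ∘ next)                                ≡⟨ sumFin-last (f ∘ next) ⟩
  sumFin (f ∘ next ∘ inject₁) + f (next (fromℕ k)) ≡⟨ cong₂ _+_ (sumFin-cong (cong f ∘ next-inject₁))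
                                                                 (cong f (next-fromℕ k)) ⟩
  sumFin (f ∘ Fin.suc) + f Fin.zero                ≡⟨ +-comm _ (f Fin.zero) ⟩
  sumFin f                                         ∎

sumFin-cong-except : ∀ {k} {f g : Fin k → ℕ} {c} (j₀ : Fin k) →
  (∀ j → j ≢ j₀ → f j ≡ g j) → f j₀ ≡ g j₀ + c → sumFin f ≡ sumFin g + c
sumFin-cong-except {f = f} {g} {c} Fin.zero f≡g fj₀ = begin
  f Fin.zero + sumFin (f ∘ Fin.suc)       ≡⟨ cong₂ _+_ fj₀ (sumFin-cong (λ j → f≡g (Fin.suc j) λ ())) ⟩
  (g Fin.zero + c) + sumFin (g ∘ Fin.suc) ≡⟨ +-assoc (g Fin.zero) c _ ⟩
  g Fin.zero + (c + sumFin (g ∘ Fin.suc)) ≡⟨ cong (g Fin.zero +_) (+-comm c _) ⟩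
  g Fin.zero + (sumFin (g ∘ Fin.suc) + c) ≡⟨ sym (+-assoc (g Fin.zero) _ c) ⟩
  sumFin g + c                            ∎
sumFin-cong-except {f = f} {g} {c} (Fin.suc j₀) f≡g fj₀ = begin
  f Fin.zero + sumFin (f ∘ Fin.suc)
    ≡⟨ cong₂ _+_ (f≡g Fin.zero λ ())
                 (sumFin-cong-except j₀ (λ j j≢j₀ → f≡g (Fin.suc j) (j≢j₀ ∘ suc-injective)) fj₀) ⟩
  g Fin.zero + (sumFin (g ∘ Fin.suc) + c) ≡⟨ sym (+-assoc (g Fin.zero) _ c) ⟩
  sumFin g + c                            ∎

module _ {n m : ℕ} (N : CRN n m) where

  speciesDeg : (Edge n m → ℕ) → Complex n → ℕ
  speciesDeg μ z = sumFin λ s → μ (inj₁ s) * ind (inSupp z s)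

  reactionDeg : (Edge n m → ℕ) → Fin m → ℕ
  reactionDeg μ i = sumFin λ j → μ (inj₂ j) * ind (mem N (inj₂ j) (u i))

  deg-u : ∀ μ i → deg N μ (u i) ≡ speciesDeg μ (reactant N i) + reactionDeg μ i
  deg-u μ i = refl

  -- The reaction edge E_i contains u i and v i alike, so reactionDeg serves both.
  deg-v : ∀ μ i → deg N μ (v i) ≡ speciesDeg μ (product N i) + reactionDeg μ i
  deg-v μ i = refl

  module _ {k : ℕ} (C : Cycle N k) where

    rxn-injective : ∀ {i j} → rxn C i ≡ rxn C j → i ≡ j
    rxn-injective {i} {j} eq =
      y-inj C i j (trans (sym (rxn-src C i)) (trans (cong (reactant N) eq) (rxn-src C j)))

    cycleSum : (Fin m → Vertex m) → (Edge n m → ℕ) → ℕ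
    cycleSum σ μ = sumFin λ j → deg N μ (σ (rxn C j))

    cycleSum-u≡v : ∀ μ → cycleSum u μ ≡ cycleSum v μ
    cycleSum-u≡v μ = begin
      cycleSum u μ
        ≡⟨ sumFin-cong (λ j → trans (deg-u μ (rxn C j)) (cong (λ z → S z + R j) (rxn-src C j))) ⟩
      sumFin (λ j → S (y C j) + R j)     ≡⟨ sumFin-+ (S ∘ y C) R ⟩
      sumFin (S ∘ y C) + sumFin R        ≡⟨ cong (_+ sumFin R) (sym (sumFin-next (S ∘ y C))) ⟩
      sumFin (S ∘ y C ∘ next) + sumFin R ≡⟨ sym (sumFin-+ (S ∘ y C ∘ next) R) ⟩
      sumFin (λ j → S (y C (next j)) + R j)
        ≡⟨ sym (sumFin-cong (λ j → trans (deg-v μ (rxn C j)) (cong (λ z → S z + R j) (rxn-tgt C j)))) ⟩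
      cycleSum v μ ∎
      where
      S : Complex n → ℕ
      S = speciesDeg μ
      R : Fin (suc k) → ℕ
      R = reactionDeg μ ∘ rxn C

    module _ (r b : Edge n m → ℕ) {w : Vertex m}
             (balanced : ∀ z → z ≢ w → deg N r z ≡ deg N b z) where

      cycleSum-balanced : ∀ σ → (∀ i → σ i ≢ w) → cycleSum σ r ≡ cycleSum σ b
      cycleSum-balanced σ σ≢w = sumFin-cong λ j → balanced _ (σ≢w (rxn C j))

      cycleSum-defect : ∀ {c} σ → (∀ {i i′} → σ i ≡ σ i′ → i ≡ i′) → ∀ j₀ → w ≡ σ (rxn C j₀) →
        deg N r w ≡ deg N b w + c → cycleSum σ r ≡ cycleSum σ b + c
      cycleSum-defect σ σ-injective j₀ refl defect = sumFin-cong-except j₀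
        (λ j j≢j₀ → balanced _ (j≢j₀ ∘ rxn-injective ∘ σ-injective)) defect

u-injective : ∀ {m} {i i′ : Fin m} → u i ≡ u i′ → i ≡ i′
u-injective refl = refl

v-injective : ∀ {m} {i i′ : Fin m} → v i ≡ v i′ → i ≡ i′
v-injective refl = refl

positive-≢-+ : ∀ {a c} → 0 < c → a + c ≢ a
positive-≢-+ {a} {c} 0<c a+c≡a = <⇒≢ 0<c (sym (+-cancelˡ-≡ a c 0 (trans a+c≡a (sym (+-identityʳ a)))))

proposition3p10 : (n m : ℕ) (N : CRN n m) (k : ℕ) (C : Cycle N k) (j : Fin (suc k)) →
    ¬ AlmostBalanced N (u (rxn C j)) × ¬ AlmostBalanced N (v (rxn C j))
proposition3p10 n m N k C j = reactant-side , product-side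
  where
  reactant-side : ¬ AlmostBalanced N (u (rxn C j))
  reactant-side (r , b , c , 0<c , defect , balanced) = positive-≢-+ 0<c (begin
    cycleSum N C u b + c ≡⟨ sym (cycleSum-defect N C r b balanced u u-injective j refl defect) ⟩
    cycleSum N C u r     ≡⟨ cycleSum-u≡v N C r ⟩
    cycleSum N C v r     ≡⟨ cycleSum-balanced N C r b balanced v (λ _ ()) ⟩
    cycleSum N C v b     ≡⟨ sym (cycleSum-u≡v N C b) ⟩
    cycleSum N C u b     ∎)

  product-side : ¬ AlmostBalanced N (v (rxn C j))
  product-side (r , b , c , 0<c , defect , balanced) = positive-≢-+ 0<c (begin
    cycleSum N C v b + c ≡⟨ sym (cycleSum-defect N C r b balanced v v-injective j refl defect) ⟩
    cycleSum N C v r     ≡⟨ sym (cycleSum-u≡v N C r) ⟩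
    cycleSum N C u r     ≡⟨ cycleSum-balanced N C r b balanced u (λ _ ()) ⟩
    cycleSum N C u b     ≡⟨ cycleSum-u≡v N C b ⟩
    cycleSum N C v b     ∎)
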